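{- Let $\mathcal{C}$ be a category with countable coproducts, $I$ an object and $F\colon\mathcal{C}\to\mathcal{C}$ a functor admitting precise factorizations with respect to the class $\mathrm{Mor}$ of all morphisms. For a pointed $F$-coalgebra $(C,c,i_C)$ define $T_k$, $h_k\colon T_k\to C$ and $F$-precise $t_k\colon T_k\to FT_{k+1}$ ($k\in\mathbb{N}$) by $T_0=I$, $h_0=i_C$, and, for each $k$, $c\cdot h_k=Fh_{k+1}\cdot t_k$ is a precise factorization of $c\cdot h_k$ (with $t_k$ $F$-precise). Equip $\coprod_{k\in\mathbb{N}}T_k$ with the coalgebra structure $[F\mathsf{in}_{k+1}]_{k\in\mathbb{N}}\cdot\coprod_kt_k$ and point $\mathsf{in}_0\colon I=T_0\to\coprod_kT_k$. Then $[h_k]_{k\in\mathbb{N}}\colon\coprod_kT_k\to C$ (the coproduct of levels) is a tree unravelling of $(C,c,i_C)$, i.e. a pointed coalgebra morphism whose domain is a tree.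
   Context: A morphism $p\colon P\to FR$ is $F$-precise (w.r.t. all morphisms) if for all $f\colon P\to FC'$, $m\colon R\to D$, $h\colon C'\to D$ with $Fm\cdot p=Fh\cdot f$ there is $d\colon R\to C'$ with $Fd\cdot p=f$ and $h\cdot d=m$. $F$ admits precise factorizations if every $f\colon S\to FY$ can be written $f=Fh\cdot p$ with $h\colon R\to Y$ arbitrary and $p\colon S\to FR$ $F$-precise (a precise factorization). A pointed $F$-coalgebra is $(C,c,i_C)$ with $c\colon C\to FC$, $i_C\colon I\to C$; a pointed coalgebra morphism $h\colon(T,t,i_T)\to(C,c,i_C)$ satisfies $c\cdot h=Fh\cdot t$ and $h\cdot i_T=i_C$; it is a split epimorphism of pointed coalgebras if some pointed coalgebra morphism $s$ has $h\cdot s=\mathrm{id}$. A pointed coalgebra is a tree if every pointed coalgebra morphism into it is a split epimorphism of pointed coalgebras. -}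

module Defs where

open import Level using (Level; _⊔_) renaming (suc to lsuc)
open import Data.Nat using (ℕ; zero; suc)
open import Data.Product using (Σ; Σ-syntax; _×_; _,_)
open import Relation.Binary.PropositionalEquality using (_≡_)

record Category (o ℓ : Level) : Set (lsuc (o ⊔ ℓ)) where
  infixr 9 _∘_
  infix 4 _⇒_
  field
    Obj : Set o
    _⇒_ : Obj → Obj → Set ℓ
    id  : ∀ {A} → A ⇒ A
    _∘_ : ∀ {A B C} → B ⇒ C → A ⇒ B → A ⇒ C
    identityˡ : ∀ {A B} (f : A ⇒ B) → id ∘ f ≡ f
    identityʳ : ∀ {A B} (f : A ⇒ B) → f ∘ id ≡ f
    assoc : ∀ {A B C D} (f : A ⇒ B) (g : B ⇒ C) (h : C ⇒ D) →
            (h ∘ g) ∘ f ≡ h ∘ (g ∘ f)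

record Endofunctor {o ℓ} (𝒞 : Category o ℓ) : Set (o ⊔ ℓ) where
  open Category 𝒞
  field
    F₀ : Obj → Obj
    F₁ : ∀ {A B} → A ⇒ B → F₀ A ⇒ F₀ B
    F-id : ∀ {A} → F₁ (id {A}) ≡ id
    F-∘ : ∀ {A B C} (f : A ⇒ B) (g : B ⇒ C) → F₁ (g ∘ f) ≡ F₁ g ∘ F₁ f

module _ {o ℓ} (𝒞 : Category o ℓ) where
  open Category 𝒞

  record CountableCoproduct (A : ℕ → Obj) : Set (o ⊔ ℓ) where
    field
      ∐   : Obj
      inj : ∀ k → A k ⇒ ∐
      [_] : ∀ {X} → (∀ k → A k ⇒ X) → ∐ ⇒ X
      commute : ∀ {X} (f : ∀ k → A k ⇒ X) k → [ f ] ∘ inj k ≡ f k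
      unique  : ∀ {X} (f : ∀ k → A k ⇒ X) (g : ∐ ⇒ X) →
                (∀ k → g ∘ inj k ≡ f k) → g ≡ [ f ]

  HasCountableCoproducts : Set (o ⊔ ℓ)
  HasCountableCoproducts = (A : ℕ → Obj) → CountableCoproduct A

module _ {o ℓ} {𝒞 : Category o ℓ} (F : Endofunctor 𝒞) where
  open Category 𝒞
  open Endofunctor F

  IsPrecise : ∀ {P R} → P ⇒ F₀ R → Set (o ⊔ ℓ)
  IsPrecise {P} {R} p =
    ∀ {C' D} (f : P ⇒ F₀ C') (m : R ⇒ D) (h : C' ⇒ D) →
    F₁ m ∘ p ≡ F₁ h ∘ f →
    Σ[ d ∈ R ⇒ C' ] (F₁ d ∘ p ≡ f × h ∘ d ≡ m)

  IsPreciseFactorization : ∀ {S Y R} → S ⇒ F₀ Y → R ⇒ Y → S ⇒ F₀ R → Set (o ⊔ ℓ)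
  IsPreciseFactorization f h p = (f ≡ F₁ h ∘ p) × IsPrecise p

  AdmitsPreciseFactorizations : Set (o ⊔ ℓ)
  AdmitsPreciseFactorizations =
    ∀ {S Y} (f : S ⇒ F₀ Y) →
    Σ[ R ∈ Obj ] Σ[ h ∈ R ⇒ Y ] Σ[ p ∈ S ⇒ F₀ R ] IsPreciseFactorization f h p

  record PointedCoalgebra (I : Obj) : Set (o ⊔ ℓ) where
    constructor pcoalg
    field
      carrier : Obj
      str     : carrier ⇒ F₀ carrier
      pt      : I ⇒ carrier

  module _ {I : Obj} where
    open PointedCoalgebra

    IsPointedCoalgebraMorphism : (A B : PointedCoalgebra I) → carrier A ⇒ carrier B → Set ℓ
    IsPointedCoalgebraMorphism A B h =
      (str B ∘ h ≡ F₁ h ∘ str A) × (h ∘ pt A ≡ pt B)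

    PointedCoalgebraMorphism : (A B : PointedCoalgebra I) → Set ℓ
    PointedCoalgebraMorphism A B =
      Σ[ h ∈ carrier A ⇒ carrier B ] IsPointedCoalgebraMorphism A B h

    IsSplitEpi : {A B : PointedCoalgebra I} → PointedCoalgebraMorphism A B → Set ℓ
    IsSplitEpi {A} {B} (h , _) =
      Σ[ s ∈ PointedCoalgebraMorphism B A ] (h ∘ Σ.proj₁ s ≡ id)

    IsTree : PointedCoalgebra I → Set (o ⊔ ℓ)
    IsTree B = (A : PointedCoalgebra I) (h : PointedCoalgebraMorphism A B) → IsSplitEpi h

    IsTreeUnravelling : (A B : PointedCoalgebra I) → carrier A ⇒ carrier B → Set (o ⊔ ℓ)
    IsTreeUnravelling A B h = IsPointedCoalgebraMorphism A B h × IsTree A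

-- Level sequences with T 0 = I definitionally: levels ≥ 1 given by a family T⁺
module _ {a} {A : Set a} where
  startAt : A → (ℕ → A) → ℕ → A
  startAt x f zero = x
  startAt x f (suc k) = f k

module _ {o ℓ} {𝒞 : Category o ℓ} (cop : HasCountableCoproducts 𝒞) (F : Endofunctor 𝒞) where
  open Category 𝒞
  open Endofunctor F
  open CountableCoproduct

  -- T = levels with T 0 = I;  structure [F inₖ₊₁]ₖ · ∐ₖ tₖ,  point in₀ : I = T₀ → ∐ T
  levelsCoalgebra : (I : Obj) (T⁺ : ℕ → Obj) →
                    (t : ∀ k → startAt I T⁺ k ⇒ F₀ (startAt I T⁺ (suc k))) →
                    PointedCoalgebra F I
  levelsCoalgebra I T⁺ t =
    pcoalg (∐ (cop T))
           ([ cop (λ k → F₀ (T (suc k))) ] (λ k → F₁ (inj (cop T) (suc k)))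
              ∘ [ cop T ] (λ k → inj (cop (λ j → F₀ (T (suc j)))) k ∘ t k))
           (inj (cop T) 0)
    where T = startAt I T⁺

{-# OPTIONS --safe #-}
module Submission where

-- A pointed coalgebra morphism g : B → ∐ₖ Tₖ is split level by level: s₀ is the
-- point of B, and sₖ₊₁ is the diagonal fill-in given by the precision of tₖ for
-- the square F inₖ₊₁ · tₖ = F g · (b · sₖ).

open import Defs
open import Level using (Level)
open import Data.Nat using (ℕ; zero; suc)
open import Data.Product using (Σ-syntax; _×_; _,_; proj₁; proj₂)
open import Relation.Binary.PropositionalEquality using (_≡_; refl; sym; trans; cong; module ≡-Reasoning)

module _ {o ℓ} {𝒞 : Category o ℓ} {A : ℕ → Category.Obj 𝒞}
         (K : CountableCoproduct 𝒞 A) where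
  open Category 𝒞
  open CountableCoproduct K

  inj-jointly-epic : ∀ {X} (g₁ g₂ : ∐ ⇒ X) → (∀ k → g₁ ∘ inj k ≡ g₂ ∘ inj k) → g₁ ≡ g₂
  inj-jointly-epic g₁ g₂ eq =
    trans (unique (λ k → g₂ ∘ inj k) g₁ eq) (sym (unique (λ k → g₂ ∘ inj k) g₂ (λ _ → refl)))

module Levels {o ℓ} {𝒞 : Category o ℓ} (cop : HasCountableCoproducts 𝒞) (F : Endofunctor 𝒞)
              (I : Category.Obj 𝒞) (T⁺ : ℕ → Category.Obj 𝒞)
              (t : ∀ k → Category._⇒_ 𝒞 (startAt I T⁺ k) (Endofunctor.F₀ F (startAt I T⁺ (suc k))))
              where
  open Category 𝒞
  open Endofunctor F
  open PointedCoalgebra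
  open CountableCoproduct (cop (startAt I T⁺))
  open ≡-Reasoning

  T : ℕ → Obj
  T = startAt I T⁺

  ∐T : PointedCoalgebra F I
  ∐T = levelsCoalgebra cop F I T⁺ t

  str∘inj : ∀ k → str ∐T ∘ inj k ≡ F₁ (inj (suc k)) ∘ t k
  str∘inj k = begin
    (shift ∘ ∐t) ∘ inj k          ≡⟨ assoc _ _ _ ⟩
    shift ∘ (∐t ∘ inj k)          ≡⟨ cong (shift ∘_) (commute _ k) ⟩
    shift ∘ (inj′ k ∘ t k)        ≡⟨ sym (assoc _ _ _) ⟩
    (shift ∘ inj′ k) ∘ t k        ≡⟨ cong (_∘ t k) (CountableCoproduct.commute K′ _ k) ⟩
    F₁ (inj (suc k)) ∘ t k        ∎
    where
    K′ = cop (λ k → F₀ (T (suc k)))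
    inj′ = CountableCoproduct.inj K′
    shift = CountableCoproduct.[_] K′ (λ k → F₁ (inj (suc k)))
    ∐t = [ (λ k → inj′ k ∘ t k) ]

  []-isMorphism : (X : PointedCoalgebra F I) (g : ∀ k → T k ⇒ carrier X) →
                  g zero ≡ pt X → (∀ k → str X ∘ g k ≡ F₁ (g (suc k)) ∘ t k) →
                  IsPointedCoalgebraMorphism F ∐T X [ g ]
  []-isMorphism X g g-pt g-str =
    inj-jointly-epic (cop T) _ _ square , trans (commute g zero) g-pt
    where
    square : ∀ k → (str X ∘ [ g ]) ∘ inj k ≡ (F₁ [ g ] ∘ str ∐T) ∘ inj k
    square k = begin
      (str X ∘ [ g ]) ∘ inj k                ≡⟨ assoc _ _ _ ⟩
      str X ∘ ([ g ] ∘ inj k)                ≡⟨ cong (str X ∘_) (commute g k) ⟩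
      str X ∘ g k                            ≡⟨ g-str k ⟩
      F₁ (g (suc k)) ∘ t k                   ≡⟨ cong (λ u → F₁ u ∘ t k) (sym (commute g (suc k))) ⟩
      F₁ ([ g ] ∘ inj (suc k)) ∘ t k         ≡⟨ cong (_∘ t k) (F-∘ _ _) ⟩
      (F₁ [ g ] ∘ F₁ (inj (suc k))) ∘ t k    ≡⟨ assoc _ _ _ ⟩
      F₁ [ g ] ∘ (F₁ (inj (suc k)) ∘ t k)    ≡⟨ cong (F₁ [ g ] ∘_) (sym (str∘inj k)) ⟩
      F₁ [ g ] ∘ (str ∐T ∘ inj k)            ≡⟨ sym (assoc _ _ _) ⟩
      (F₁ [ g ] ∘ str ∐T) ∘ inj k            ∎

  module Section (precise : ∀ k → IsPrecise F (t k))
                 (B : PointedCoalgebra F I) (g : carrier B ⇒ carrier ∐T)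
                 (g-str : str ∐T ∘ g ≡ F₁ g ∘ str B) (g-pt : g ∘ pt B ≡ inj zero) where

    section : ∀ k → Σ[ s ∈ T k ⇒ carrier B ] (g ∘ s ≡ inj k)
    section-step : ∀ k → Σ[ d ∈ T (suc k) ⇒ carrier B ]
                   ((F₁ d ∘ t k ≡ str B ∘ proj₁ (section k)) × (g ∘ d ≡ inj (suc k)))

    section zero = pt B , g-pt
    section (suc k) = proj₁ (section-step k) , proj₂ (proj₂ (section-step k))

    section-step k = precise k (str B ∘ sₖ) (inj (suc k)) g (begin
      F₁ (inj (suc k)) ∘ t k   ≡⟨ sym (str∘inj k) ⟩
      str ∐T ∘ inj k           ≡⟨ cong (str ∐T ∘_) (sym g∘sₖ) ⟩
      str ∐T ∘ (g ∘ sₖ)        ≡⟨ sym (assoc _ _ _) ⟩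
      (str ∐T ∘ g) ∘ sₖ        ≡⟨ cong (_∘ sₖ) g-str ⟩
      (F₁ g ∘ str B) ∘ sₖ      ≡⟨ assoc _ _ _ ⟩
      F₁ g ∘ (str B ∘ sₖ)      ∎)
      where
      sₖ = proj₁ (section k)
      g∘sₖ = proj₂ (section k)

    s : ∐ ⇒ carrier B
    s = [ (λ k → proj₁ (section k)) ]

    s-isMorphism : IsPointedCoalgebraMorphism F ∐T B s
    s-isMorphism = []-isMorphism B (λ k → proj₁ (section k)) refl
                                 (λ k → sym (proj₁ (proj₂ (section-step k))))

    g∘s≡id : g ∘ s ≡ id
    g∘s≡id = inj-jointly-epic (cop T) _ _ λ k → begin
      (g ∘ s) ∘ inj k         ≡⟨ assoc _ _ _ ⟩
      g ∘ (s ∘ inj k)         ≡⟨ cong (g ∘_) (commute _ k) ⟩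
      g ∘ proj₁ (section k)   ≡⟨ proj₂ (section k) ⟩
      inj k                   ≡⟨ sym (identityˡ _) ⟩
      id ∘ inj k              ∎

  ∐T-isTree : (∀ k → IsPrecise F (t k)) → IsTree F ∐T
  ∐T-isTree precise B (g , g-str , g-pt) = (s , s-isMorphism) , g∘s≡id
    where open Section precise B g g-str g-pt

theorem5p19 : ∀ {o ℓ : Level} (𝒞 : Category o ℓ) (cop : HasCountableCoproducts 𝒞)
    (I : Category.Obj 𝒞) (F : Endofunctor 𝒞) →
    AdmitsPreciseFactorizations F →
    (C : PointedCoalgebra F I) →
    (T⁺ : ℕ → Category.Obj 𝒞) →
    (h : ∀ k → Category._⇒_ 𝒞 (startAt I T⁺ k) (PointedCoalgebra.carrier C)) →
    (t : ∀ k → Category._⇒_ 𝒞 (startAt I T⁺ k) (Endofunctor.F₀ F (startAt I T⁺ (suc k)))) →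
    h zero ≡ PointedCoalgebra.pt C →
    (∀ k → IsPreciseFactorization F
             (Category._∘_ 𝒞 (PointedCoalgebra.str C) (h k)) (h (suc k)) (t k)) →
    IsTreeUnravelling F (levelsCoalgebra cop F I T⁺ t) C
      (CountableCoproduct.[_] (cop (startAt I T⁺)) h)
theorem5p19 𝒞 cop I F _ C T⁺ h t h-pt factorization =
  []-isMorphism C h h-pt (λ k → proj₁ (factorization k)) ,
  ∐T-isTree (λ k → proj₂ (factorization k))
  where open Levels cop F I T⁺ t
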